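{- Let types be generated by $\tau,\sigma ::= p \mid \tau+\sigma \mid \tau\times\sigma \mid \tau\to\sigma$ over a set of atomic types $p$, and let $\mathrm{enf}$ be the exp-log normalization function defined in the context below. Then for every type $\tau$, $\mathrm{enf}(\tau)$ is well defined, and the type it denotes is a type in exp-log normal form, i.e. it belongs to the class $\mathrm{ENF}$ generated by the grammar \[ \mathrm{ENF}\ni e ::= c \mid d,\qquad \mathrm{DNF}\ni d ::= c_1 + (c_2 + (\cdots + c_n)\cdots)\ (n\ge 2), \] \[ \mathrm{CNF}\ni c ::= (c_1\to b_1)\times(\cdots\times(c_n\to b_n)\cdots)\ (n\ge 0),\qquad \mathrm{Base}\ni b ::= p \mid d, \] where $p$ ranges over atomic types and the empty product ($n=0$) is the unit type $1$.
   Context: Normal-form syntax: $\mathrm{CNF}$ objects are $\top$ or $\mathrm{con}(c_1,b,c_2)$; $\mathrm{DNF}$ objects are $\mathrm{two}(c_1,c_2)$ or $\mathrm{dis}(c,d)$; $\mathrm{Base}$ objects are $\mathrm{prp}(p)$ or $\mathrm{bd}(d)$; $\mathrm{ENF}$ objects are $\mathrm{cnf}(c)$ or $\mathrm{dnf}(d)$. They denote types by: $\top=1$, $\mathrm{con}(c_1,b,c_2)=(c_1\to b)\times c_2$, $\mathrm{two}(c_1,c_2)=c_1+c_2$, $\mathrm{dis}(c,d)=c+d$, $\mathrm{prp}(p)=p$, $\mathrm{bd}(d)=d$, $\mathrm{cnf}(c)=c$, $\mathrm{dnf}(d)=d$. Auxiliary functions (defined by structural recursion): $\mathrm{ntimes}(\top,c_2)=c_2$;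 $\mathrm{ntimes}(\mathrm{con}(c,b,c'),c_2)=\mathrm{con}(c,b,\mathrm{ntimes}(c',c_2))$. $\mathrm{nplus1}(\mathrm{two}(c,c_0),\mathrm{cnf}(c_1))=\mathrm{dis}(c,\mathrm{two}(c_0,c_1))$; $\mathrm{nplus1}(\mathrm{two}(c,c_0),\mathrm{dnf}(d_0))=\mathrm{dis}(c,\mathrm{dis}(c_0,d_0))$; $\mathrm{nplus1}(\mathrm{dis}(c,d_0),e)=\mathrm{dis}(c,\mathrm{nplus1}(d_0,e))$. $\mathrm{nplus}(\mathrm{cnf}(a),\mathrm{cnf}(c))=\mathrm{two}(a,c)$; $\mathrm{nplus}(\mathrm{cnf}(a),\mathrm{dnf}(d))=\mathrm{dis}(a,d)$; $\mathrm{nplus}(\mathrm{dnf}(d),e)=\mathrm{nplus1}(d,e)$. $\mathrm{distrib0}(c,\mathrm{two}(c_0,c_1))=\mathrm{dnf}(\mathrm{two}(\mathrm{ntimes}(c,c_0),\mathrm{ntimes}(c,c_1)))$; $\mathrm{distrib0}(c,\mathrm{dis}(c_0,d_0))$ equals $\mathrm{dnf}(\mathrm{two}(\mathrm{ntimes}(c,c_0),c_1))$ if $\mathrm{distrib0}(c,d_0)=\mathrm{cnf}(c_1)$, and $\mathrm{dnf}(\mathrm{dis}(\mathrm{ntimes}(c,c_0),d_1))$ if $\mathrm{distrib0}(c,d_0)=\mathrm{dnf}(d_1)$. $\mathrm{distrib1}(c,\mathrm{cnf}(a))=\mathrm{cnf}(\mathrm{ntimes}(c,a))$; $\mathrm{distrib1}(c,\mathrm{dnf}(d))=\mathrm{distrib0}(c,d)$.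 $\mathrm{distribn}(\mathrm{two}(c,c_0),e)=\mathrm{dnf}(\mathrm{nplus}(\mathrm{distrib1}(c,e),\mathrm{distrib1}(c_0,e)))$; $\mathrm{distribn}(\mathrm{dis}(c,d_0),e)=\mathrm{dnf}(\mathrm{nplus}(\mathrm{distrib1}(c,e),\mathrm{distribn}(d_0,e)))$. $\mathrm{distrib}(\mathrm{cnf}(a),e)=\mathrm{distrib1}(a,e)$; $\mathrm{distrib}(\mathrm{dnf}(d),e)=\mathrm{distribn}(d,e)$. $\mathrm{explog0}(b,\mathrm{two}(c_1,c_2))=\mathrm{ntimes}(\mathrm{con}(c_1,b,\top),\mathrm{con}(c_2,b,\top))$; $\mathrm{explog0}(b,\mathrm{dis}(c,d))=\mathrm{ntimes}(\mathrm{con}(c,b,\top),\mathrm{explog0}(b,d))$. $\mathrm{explog1}(b,\mathrm{cnf}(c))=\mathrm{con}(c,b,\top)$; $\mathrm{explog1}(b,\mathrm{dnf}(d))=\mathrm{explog0}(b,d)$. $\mathrm{explogn}(\top,e)=\top$; $\mathrm{explogn}(\mathrm{con}(c_1,b,c_2),e)=\mathrm{ntimes}(\mathrm{explog1}(b,\mathrm{distrib1}(c_1,e)),\mathrm{explogn}(c_2,e))$. $\mathrm{p2c}(p)=\mathrm{con}(\top,\mathrm{prp}(p),\top)$; $\mathrm{enf2cnf}(\mathrm{cnf}(c))=c$; $\mathrm{enf2cnf}(\mathrm{dnf}(d))=\mathrm{con}(\top,\mathrm{bd}(d),\top)$. Exp-log normalization: $\mathrm{enf}(p)=\mathrm{cnf}(\mathrm{p2c}(p))$;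 $\mathrm{enf}(\tau+\sigma)=\mathrm{dnf}(\mathrm{nplus}(\mathrm{enf}(\tau),\mathrm{enf}(\sigma)))$; $\mathrm{enf}(\tau\times\sigma)=\mathrm{distrib}(\mathrm{enf}(\tau),\mathrm{enf}(\sigma))$; $\mathrm{enf}(\tau\to\sigma)=\mathrm{cnf}(\mathrm{explogn}(\mathrm{enf2cnf}(\mathrm{enf}(\sigma)),\mathrm{enf}(\tau)))$. A type is said to be in exp-log normal form if it is (the type denoted by) $\mathrm{enf}(\tau)$ for some type $\tau$. -}

module Defs where

data Ty (A : Set) : Set where
  atom : A → Ty A
  _⊕_  : Ty A → Ty A → Ty A
  _⊗_  : Ty A → Ty A → Ty A
  _⇒_  : Ty A → Ty A → Ty A

-- Target types: as above plus the unit type 1 (needed to denote normal forms).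
data Ty₁ (A : Set) : Set where
  atom : A → Ty₁ A
  𝟙    : Ty₁ A
  _⊕_  : Ty₁ A → Ty₁ A → Ty₁ A
  _⊗_  : Ty₁ A → Ty₁ A → Ty₁ A
  _⇒_  : Ty₁ A → Ty₁ A → Ty₁ A

module _ {A : Set} where
  mutual
    data CNF : Set where
      ⊤c  : CNF
      con : CNF → Base → CNF → CNF

    data DNF : Set where
      two : CNF → CNF → DNF
      dis : CNF → DNF → DNF

    data Base : Set where
      prp : A → Base
      bd  : DNF → Base

  data ENF : Set where
    cnf : CNF → ENF
    dnf : DNF → ENF

  mutual
    ⟦_⟧c : CNF → Ty₁ A
    ⟦ ⊤c ⟧c = 𝟙
    ⟦ con c₁ b c₂ ⟧c = (⟦ c₁ ⟧c ⇒ ⟦ b ⟧b) ⊗ ⟦ c₂ ⟧c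

    ⟦_⟧d : DNF → Ty₁ A
    ⟦ two c₁ c₂ ⟧d = ⟦ c₁ ⟧c ⊕ ⟦ c₂ ⟧c
    ⟦ dis c d ⟧d = ⟦ c ⟧c ⊕ ⟦ d ⟧d

    ⟦_⟧b : Base → Ty₁ A
    ⟦ prp p ⟧b = atom p
    ⟦ bd d ⟧b = ⟦ d ⟧d

  ⟦_⟧e : ENF → Ty₁ A
  ⟦ cnf c ⟧e = ⟦ c ⟧c
  ⟦ dnf d ⟧e = ⟦ d ⟧d

  ntimes : CNF → CNF → CNF
  ntimes ⊤c c₂ = c₂
  ntimes (con c b c') c₂ = con c b (ntimes c' c₂)

  nplus1 : DNF → ENF → DNF
  nplus1 (two c c₀) (cnf c₁) = dis c (two c₀ c₁)
  nplus1 (two c c₀) (dnf d₀) = dis c (dis c₀ d₀)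
  nplus1 (dis c d₀) e = dis c (nplus1 d₀ e)

  nplus : ENF → ENF → DNF
  nplus (cnf a) (cnf c) = two a c
  nplus (cnf a) (dnf d) = dis a d
  nplus (dnf d) e = nplus1 d e

  distrib0 : CNF → DNF → ENF
  distrib0 c (two c₀ c₁) = dnf (two (ntimes c c₀) (ntimes c c₁))
  distrib0 c (dis c₀ d₀) with distrib0 c d₀
  ... | cnf c₁ = dnf (two (ntimes c c₀) c₁)
  ... | dnf d₁ = dnf (dis (ntimes c c₀) d₁)

  distrib1 : CNF → ENF → ENF
  distrib1 c (cnf a) = cnf (ntimes c a)
  distrib1 c (dnf d) = distrib0 c d

  distribn : DNF → ENF → ENF
  distribn (two c c₀) e = dnf (nplus (distrib1 c e) (distrib1 c₀ e))
  distribn (dis c d₀) e = dnf (nplus (distrib1 c e) (distribn d₀ e))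

  distrib : ENF → ENF → ENF
  distrib (cnf a) e = distrib1 a e
  distrib (dnf d) e = distribn d e

  explog0 : Base → DNF → CNF
  explog0 b (two c₁ c₂) = ntimes (con c₁ b ⊤c) (con c₂ b ⊤c)
  explog0 b (dis c d) = ntimes (con c b ⊤c) (explog0 b d)

  explog1 : Base → ENF → CNF
  explog1 b (cnf c) = con c b ⊤c
  explog1 b (dnf d) = explog0 b d

  explogn : CNF → ENF → CNF
  explogn ⊤c e = ⊤c
  explogn (con c₁ b c₂) e = ntimes (explog1 b (distrib1 c₁ e)) (explogn c₂ e)

  p2c : A → CNF
  p2c p = con ⊤c (prp p) ⊤c

  enf2cnf : ENF → CNF
  enf2cnf (cnf c) = c
  enf2cnf (dnf d) = con ⊤c (bd d) ⊤c

  -- Exp-log normalization (total by structural recursion: "well defined")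
  enf : Ty A → ENF
  enf (atom p) = cnf (p2c p)
  enf (τ ⊕ σ) = dnf (nplus (enf τ) (enf σ))
  enf (τ ⊗ σ) = distrib (enf τ) (enf σ)
  enf (τ ⇒ σ) = cnf (explogn (enf2cnf (enf σ)) (enf τ))

  -- CNF ∋ c ::= (c₁ → b₁) × (⋯ × ((cₙ → bₙ) × 1)⋯)   (n ≥ 0; empty product is 1)
  --   DNF ∋ d ::= c₁ + (c₂ + (⋯ + cₙ)⋯)                (n ≥ 2)
  --   Base ∋ b ::= p | d
  --   ENF ∋ e ::= c | d
  mutual
    data IsCNF : Ty₁ A → Set where
      unit : IsCNF 𝟙
      cons : ∀ {c₁ b c₂} → IsCNF c₁ → IsBase b → IsCNF c₂ → IsCNF ((c₁ ⇒ b) ⊗ c₂)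

    data IsDNF : Ty₁ A → Set where
      two : ∀ {c₁ c₂} → IsCNF c₁ → IsCNF c₂ → IsDNF (c₁ ⊕ c₂)
      dis : ∀ {c d} → IsCNF c → IsDNF d → IsDNF (c ⊕ d)

    data IsBase : Ty₁ A → Set where
      atm : ∀ p → IsBase (atom p)
      dnf : ∀ {d} → IsDNF d → IsBase d

  data IsENF : Ty₁ A → Set where
    cnf : ∀ {c} → IsCNF c → IsENF c
    dnf : ∀ {d} → IsDNF d → IsENF d

-- The normalizer enf is defined by structural recursion on the source type,
-- so it is total ("well defined") by Agda's termination check alone.  Its
-- codomain is the normal-form syntax ENF, whose constructors mirror the
-- grammar  ENF ∋ e ::= c | d,  DNF ∋ d ::= c₁ + ⋯ + cₙ (n ≥ 2),
-- CNF ∋ c ::= (c₁ → b₁) × ⋯ × (cₙ → bₙ) (n ≥ 0),  Base ∋ b ::= p | d.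
-- Hence the whole argument is a soundness lemma for the syntax: the
-- denotation of every syntactic CNF / DNF / Base / ENF object satisfies the
-- corresponding grammar predicate IsCNF / IsDNF / IsBase / IsENF.
module Submission where

open import Defs

module _ {A : Set} where
  mutual
    cnf-sound : (c : CNF {A}) → IsCNF ⟦ c ⟧c
    cnf-sound ⊤c            = unit
    cnf-sound (con c₁ b c₂) = cons (cnf-sound c₁) (base-sound b) (cnf-sound c₂)

    dnf-sound : (d : DNF {A}) → IsDNF ⟦ d ⟧d
    dnf-sound (two c₁ c₂) = two (cnf-sound c₁) (cnf-sound c₂)
    dnf-sound (dis c d)   = dis (cnf-sound c) (dnf-sound d)

    base-sound : (b : Base {A}) → IsBase ⟦ b ⟧b
    base-sound (prp p) = atm p
    base-sound (bd d)  = dnf (dnf-sound d)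

  enf-sound : (e : ENF {A}) → IsENF ⟦ e ⟧e
  enf-sound (cnf c) = cnf (cnf-sound c)
  enf-sound (dnf d) = dnf (dnf-sound d)

theorem1 : {A : Set} (τ : Ty A) → IsENF ⟦ enf τ ⟧e
theorem1 τ = enf-sound (enf τ)
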